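{- Let $G$ be a well-covered, locally triangle-free, connected graph such that (1) $\alpha(G)\geqslant 3$; (2) $G$ is not a join of two proper subgraphs; (3) for every vertex $v$ of $G$, each nontrivial connected component of $G_v$ is in $W_2$. Then $G$ is in $W_2$.
   Context: Graphs are finite, simple, without isolated vertices. $\alpha(G)$ is the maximum size of an independent set; $G$ is well-covered if all maximal independent sets have equal size; a well-covered $G$ is in $W_2$ if removing any vertex leaves a well-covered graph with the same independence number. $G_v$ is the induced subgraph obtained by deleting $v$ and all its neighbors. $G$ is locally triangle-free if every $G_v$ is triangle-free. A component is nontrivial if it has more than one vertex. $G$ is a join of two proper subgraphs if $V(G)$ splits into two nonempty parts with every vertex of one part adjacent to every vertex of the other. -}

module Defs where

open import Data.Nat using (ℕ; _≤_)
open import Data.Bool using (Bool; true; false; not; _∧_)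
open import Data.Fin using (Fin; _≟_)
open import Data.Fin.Subset using (Subset; ∁; _∈_; _∉_; _⊆_; ⊤; ∣_∣; _-_; Nonempty)
open import Data.Vec using (tabulate)
open import Data.Empty
open import Data.Product using (Σ; _×_; _,_; ∃)
open import Relation.Nullary using (¬_; ⌊_⌋)
open import Relation.Binary.PropositionalEquality using (_≡_)

record Graph (n : ℕ) : Set where
  field
    adj   : Fin n → Fin n → Bool
    sym   : ∀ x y → adj x y ≡ adj y x
    irrefl : ∀ x → adj x x ≡ false
open Graph public

module _ {n : ℕ} (G : Graph n) where

  Adj : Fin n → Fin n → Set
  Adj x y = adj G x y ≡ true

  NoIsolated : Set
  NoIsolated = ∀ x → ∃ λ y → Adj x y

  -- All notions below are for the induced subgraph G[U] on a vertex set U.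

  Independent : Subset n → Subset n → Set
  Independent U I = I ⊆ U × (∀ {x y} → x ∈ I → y ∈ I → ¬ Adj x y)

  MaximalIndependent : Subset n → Subset n → Set
  MaximalIndependent U I =
    Independent U I × (∀ J → Independent U J → I ⊆ J → J ⊆ I)

  IsAlpha : Subset n → ℕ → Set
  IsAlpha U k =
    (∃ λ I → Independent U I × ∣ I ∣ ≡ k) × (∀ I → Independent U I → ∣ I ∣ ≤ k)

  WellCovered : Subset n → Set
  WellCovered U =
    ∀ I J → MaximalIndependent U I → MaximalIndependent U J → ∣ I ∣ ≡ ∣ J ∣

  InW2 : Subset n → Set
  InW2 U = WellCovered U ×
    (∀ v → v ∈ U → WellCovered (U - v) × (∀ k → IsAlpha U k → IsAlpha (U - v) k))

  data Walk (U : Subset n) : Fin n → Fin n → Set where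
    here : ∀ {x} → x ∈ U → Walk U x x
    step : ∀ {x y z} → x ∈ U → Adj x y → Walk U y z → Walk U x z

  Connected : Subset n → Set
  Connected U = ∀ {x y} → x ∈ U → y ∈ U → Walk U x y

  IsComponent : Subset n → Subset n → Set
  IsComponent U C = C ⊆ U × Nonempty C × Connected C ×
    (∀ {x y} → x ∈ C → y ∈ U → Adj x y → y ∈ C)

  Gv : Fin n → Subset n
  Gv v = tabulate (λ y → not ⌊ y ≟ v ⌋ ∧ not (adj G v y))

  TriangleFree : Subset n → Set
  TriangleFree U = ∀ {x y z} → x ∈ U → y ∈ U → z ∈ U →
    Adj x y → Adj y z → Adj x z → Data.Empty.⊥

  LocallyTriangleFree : Set
  LocallyTriangleFree = ∀ v → TriangleFree (Gv v)

  IsJoin : Set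
  IsJoin = Σ (Subset n) λ A → Nonempty A × Nonempty (∁ A) ×
    (∀ {x y} → x ∈ A → y ∉ A → Adj x y)

-- It suffices that every maximal independent set S of G − v is maximal in G,
-- i.e. that S contains a neighbour of v (v is not isolated).  Otherwise S is a
-- maximal independent set of G_v dominating N(v), and S ∪ {v} is maximal in G,
-- so |S| ≥ α(G) − 1 ≥ 2.  Each x ∈ S is then adjacent to all of N(v): if
-- u ∈ N(v) missed x, the component C of G_x containing the edge uv is in W₂,
-- yet C ∩ S is maximal in C − v without dominating v.  Applying this to a
-- maximal independent set of G_v through d and c shows that a vertex c of G_v
-- not adjacent to all of N(v) is adjacent to every d ∈ G_v that is.  If such a
-- c exists, the vertices adjacent to all of N(v) are independent in the
-- triangle-free G_v, and in the component C of G_v containing c and two of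
-- them, g₁ and g₂, they form a maximal independent set of C − g₁ not
-- dominating g₁.  So no such c exists, and G is the join of N(v) with its
-- complement.

module Submission where

open import Defs
open import Data.Bool using (Bool; true; false; not; _∧_)
import Data.Bool.Properties as Bool
open import Data.Empty using (⊥-elim)
open import Data.Fin using (Fin; _≟_)
open import Data.Fin.Properties using (any?; all?)
open import Data.Fin.Subset
open import Data.Fin.Subset.Properties
open import Data.Fin.Subset.Induction using (Acc; acc; ⊃-wellFounded)
open import Data.Nat using (ℕ; suc; _≤_; _<_; _+_; z≤n; s≤s; s≤s⁻¹)
open import Data.Nat.Properties using (≤-trans; ≤-antisym; <-irrefl; +-suc; +-comm; n≤1+n)
open import Data.Product using (_×_; _,_; ∃; ∃₂; proj₁; proj₂)
open import Data.Sum using (_⊎_; inj₁; inj₂)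
open import Data.Vec using ([]; _∷_; here; there; tabulate)
open import Data.Vec.Properties using ([]=⇒lookup; lookup⇒[]=; lookup∘tabulate)
open import Function using (_∘_)
open import Level using (Level)
open import Relation.Binary.PropositionalEquality using (_≡_; _≢_; refl; trans; cong; subst)
  renaming (sym to ≡-sym)
open import Relation.Nullary using (¬_; Dec; yes; no; ⌊_⌋; contradiction)
open import Relation.Nullary.Decidable using (_×-dec_; _→-dec_; ¬?; decidable-stable)
open import Relation.Unary using (Pred; Decidable)

private
  variable
    n : ℕ
    p q : Subset n
    x y : Fin n

saturate : ∀ {a b : Level} (P : Pred (Subset n) a) (Q : Pred (Subset n) b) →
           (∀ {S} → P S → Q S ⊎ ∃ λ T → S ⊂ T × P T) →
           ∀ {S} → P S → ∃ λ T → S ⊆ T × P T × Q T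
saturate P Q grow {S} = go (⊃-wellFounded S)
  where
  go : ∀ {S} → Acc _⊃_ S → P S → ∃ λ T → S ⊆ T × P T × Q T
  go {S} (acc rec) PS with grow PS
  ... | inj₁ QS = S , (λ x∈S → x∈S) , PS , QS
  ... | inj₂ (T , S⊂T , PT) with go (rec S⊂T) PT
  ...   | U , T⊆U , PU , QU = U , ⊆-trans (proj₁ S⊂T) T⊆U , PU , QU

select : ∀ {ℓ} {P : Pred (Fin n) ℓ} → Decidable P → Subset n
select P? = tabulate (λ x → ⌊ P? x ⌋)

∈select⁺ : ∀ {ℓ} {P : Pred (Fin n) ℓ} (P? : Decidable P) → P x → x ∈ select P?
∈select⁺ {x = x} {P = P} P? Px = lookup⇒[]= x (select P?) (trans (lookup∘tabulate _ x) (true-if (P? x)))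
  where
  true-if : (Px? : Dec (P x)) → ⌊ Px? ⌋ ≡ true
  true-if (yes _)  = refl
  true-if (no ¬Px) = ⊥-elim (¬Px Px)

∈select⁻ : ∀ {ℓ} {P : Pred (Fin n) ℓ} (P? : Decidable P) → x ∈ select P? → P x
∈select⁻ {x = x} P? x∈ with P? x | trans (≡-sym (lookup∘tabulate (λ y → ⌊ P? y ⌋) x)) ([]=⇒lookup x∈)
... | yes Px | _ = Px

x∈p─q⇒x∉q : x ∈ p ─ q → x ∉ q
x∈p─q⇒x∉q {p = _ ∷ _} {q = outside ∷ _} here ()
x∈p─q⇒x∉q {p = _ ∷ _} {q = _ ∷ _} (there x∈p─q) (there x∈q) = x∈p─q⇒x∉q x∈p─q x∈q

x∈p-y⇒x≢y : x ∈ p - y → x ≢ y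
x∈p-y⇒x≢y x∈p-y refl = x∈p─q⇒x∉q x∈p-y (x∈⁅x⁆ _)

x∈p∪⁅y⁆⁻ : x ∈ p ∪ ⁅ y ⁆ → x ∈ p ⊎ x ≡ y
x∈p∪⁅y⁆⁻ {p = p} {y = y} x∈ with x∈p∪q⁻ p ⁅ y ⁆ x∈
... | inj₁ x∈p = inj₁ x∈p
... | inj₂ x∈⁅y⁆ = inj₂ (x∈⁅y⁆⇒x≡y y x∈⁅y⁆)

y∈p∪⁅y⁆ : y ∈ p ∪ ⁅ y ⁆
y∈p∪⁅y⁆ {y = y} = x∈p∪q⁺ (inj₂ (x∈⁅x⁆ y))

∪⁅⁆⊆ : p ⊆ q → y ∈ q → p ∪ ⁅ y ⁆ ⊆ q
∪⁅⁆⊆ p⊆q y∈q x∈ with x∈p∪⁅y⁆⁻ x∈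
... | inj₁ x∈p = p⊆q x∈p
... | inj₂ refl = y∈q

x∈p⇒⁅x⁆⊆p : x ∈ p → ⁅ x ⁆ ⊆ p
x∈p⇒⁅x⁆⊆p {x = x} x∈p y∈⁅x⁆ with x∈⁅y⁆⇒x≡y x y∈⁅x⁆
... | refl = x∈p

p⊆p-x∪⁅x⁆ : ∀ (p : Subset n) x → p ⊆ (p - x) ∪ ⁅ x ⁆
p⊆p-x∪⁅x⁆ p x {y} y∈p with y ≟ x
... | yes refl = y∈p∪⁅y⁆
... | no y≢x = p⊆p∪q ⁅ x ⁆ (x∈p∧x≢y⇒x∈p-y y∈p y≢x)

∣p∪q∣≤∣p∣+∣q∣ : ∀ (p q : Subset n) → ∣ p ∪ q ∣ ≤ ∣ p ∣ + ∣ q ∣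
∣p∪q∣≤∣p∣+∣q∣ []            []            = z≤n
∣p∪q∣≤∣p∣+∣q∣ (inside  ∷ p) (inside  ∷ q) =
  s≤s (≤-trans (∣p∪q∣≤∣p∣+∣q∣ p q) (subst (∣ p ∣ + ∣ q ∣ ≤_) (≡-sym (+-suc ∣ p ∣ ∣ q ∣)) (n≤1+n _)))
∣p∪q∣≤∣p∣+∣q∣ (inside  ∷ p) (outside ∷ q) = s≤s (∣p∪q∣≤∣p∣+∣q∣ p q)
∣p∪q∣≤∣p∣+∣q∣ (outside ∷ p) (inside  ∷ q) =
  subst (suc ∣ p ∪ q ∣ ≤_) (≡-sym (+-suc ∣ p ∣ ∣ q ∣)) (s≤s (∣p∪q∣≤∣p∣+∣q∣ p q))
∣p∪q∣≤∣p∣+∣q∣ (outside ∷ p) (outside ∷ q) = ∣p∪q∣≤∣p∣+∣q∣ p q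

∣p∪⁅x⁆∣≤1+∣p∣ : ∀ (p : Subset n) x → ∣ p ∪ ⁅ x ⁆ ∣ ≤ suc ∣ p ∣
∣p∪⁅x⁆∣≤1+∣p∣ p x =
  subst (∣ p ∪ ⁅ x ⁆ ∣ ≤_) (trans (cong (∣ p ∣ +_) (∣⁅x⁆∣≡1 x)) (+-comm ∣ p ∣ 1)) (∣p∪q∣≤∣p∣+∣q∣ p ⁅ x ⁆)

∣p∣≤1+∣p-x∣ : ∀ (p : Subset n) x → ∣ p ∣ ≤ suc ∣ p - x ∣
∣p∣≤1+∣p-x∣ p x = ≤-trans (p⊆q⇒∣p∣≤∣q∣ (p⊆p-x∪⁅x⁆ p x)) (∣p∪⁅x⁆∣≤1+∣p∣ (p - x) x)

0<∣p∣⇒Nonempty : 0 < ∣ p ∣ → Nonempty p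
0<∣p∣⇒Nonempty {n} {p} 0<∣p∣ with nonempty? p
... | yes p≠∅ = p≠∅
... | no p≡∅ =
  ⊥-elim (<-irrefl refl (subst (0 <_) (∣⊥∣≡0 n) (subst (λ s → 0 < ∣ s ∣) (Empty-unique p≡∅) 0<∣p∣)))

2≤∣p∣⇒distinct : 2 ≤ ∣ p ∣ → ∃₂ λ x y → x ∈ p × y ∈ p × x ≢ y
2≤∣p∣⇒distinct {p = p} 2≤∣p∣ with 0<∣p∣⇒Nonempty (≤-trans (s≤s z≤n) 2≤∣p∣)
... | x , x∈p with 0<∣p∣⇒Nonempty (s≤s⁻¹ (≤-trans 2≤∣p∣ (∣p∣≤1+∣p-x∣ p x)))
...   | y , y∈p-x = x , y , x∈p , p─q⊆p p ⁅ x ⁆ y∈p-x , λ { refl → x∈p-y⇒x≢y y∈p-x refl }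

distinct⇒2≤∣p∣ : x ∈ p → y ∈ p → x ≢ y → 2 ≤ ∣ p ∣
distinct⇒2≤∣p∣ {x = x} {p = p} {y = y} x∈p y∈p x≢y = ≤-trans (s≤s 1≤∣p-x∣) (x∈p⇒∣p-x∣<∣p∣ x∈p)
  where
  1≤∣p-x∣ : 1 ≤ ∣ p - x ∣
  1≤∣p-x∣ = subst (_≤ ∣ p - x ∣) (∣⁅x⁆∣≡1 y) (p⊆q⇒∣p∣≤∣q∣ (x∈p⇒⁅x⁆⊆p (x∈p∧x≢y⇒x∈p-y y∈p (x≢y ∘ ≡-sym))))

module GraphProperties {n : ℕ} (G : Graph n) where

  private
    variable
      U S C : Subset n
      u v : Fin n

  Adj? : ∀ x y → Dec (Adj G x y)
  Adj? x y = adj G x y Bool.≟ true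

  Adj-sym : Adj G x y → Adj G y x
  Adj-sym {x} {y} = trans (sym G y x)

  Adj⇒≢ : Adj G x y → x ≢ y
  Adj⇒≢ {x} x~y refl with trans (≡-sym x~y) (irrefl G x)
  ... | ()

  walk-head : Walk G U x y → x ∈ U
  walk-head (here x∈U)     = x∈U
  walk-head (step x∈U _ _) = x∈U

  walk-mono : U ⊆ C → Walk G U x y → Walk G C x y
  walk-mono U⊆C (here x∈U)         = here (U⊆C x∈U)
  walk-mono U⊆C (step x∈U x~y w) = step (U⊆C x∈U) x~y (walk-mono U⊆C w)

  walk-++ : ∀ {z} → Walk G U x y → Walk G U y z → Walk G U x z
  walk-++ (here _)         w′ = w′
  walk-++ (step x∈U x~y w) w′ = step x∈U x~y (walk-++ w w′)

  walk-reverse : Walk G U x y → Walk G U y x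
  walk-reverse (here x∈U)         = here x∈U
  walk-reverse (step x∈U x~y w) = walk-++ (walk-reverse w) (step (walk-head w) (Adj-sym x~y) (here x∈U))

  ClosedIn : Subset n → Subset n → Set
  ClosedIn U C = ∀ {a b} → a ∈ C → b ∈ U → Adj G a b → b ∈ C

  component-of : x ∈ U → ∃ λ C → IsComponent G U C × x ∈ C
  component-of {x} {U} x∈U =
    let C , _ , (C⊆U , x∈C , walks) , closed =
          saturate Reaching (ClosedIn U) grow (x∈p⇒⁅x⁆⊆p x∈U , x∈⁅x⁆ x , ⁅x⁆-walk)
    in C , (C⊆U , (x , x∈C) , (λ a∈C b∈C → walk-++ (walks a∈C) (walk-reverse (walks b∈C))) , closed) , x∈C
    where
    Reaching : Subset n → Set
    Reaching R = R ⊆ U × x ∈ R × (∀ {y} → y ∈ R → Walk G R y x)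

    ⁅x⁆-walk : ∀ {y} → y ∈ ⁅ x ⁆ → Walk G ⁅ x ⁆ y x
    ⁅x⁆-walk y∈⁅x⁆ with x∈⁅y⁆⇒x≡y x y∈⁅x⁆
    ... | refl = here y∈⁅x⁆

    grow : ∀ {R} → Reaching R → ClosedIn U R ⊎ ∃ λ R′ → R ⊂ R′ × Reaching R′
    grow {R} (R⊆U , x∈R , walks)
      with any? (λ b → b ∈? U ×-dec ¬? (b ∈? R) ×-dec any? (λ a → a ∈? R ×-dec Adj? a b))
    ... | yes (b , b∈U , b∉R , a , a∈R , a~b) =
      inj₂ (R ∪ ⁅ b ⁆ , (p⊆p∪q ⁅ b ⁆ , b , y∈p∪⁅y⁆ , b∉R) , ∪⁅⁆⊆ R⊆U b∈U , p⊆p∪q ⁅ b ⁆ x∈R , walks′)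
      where
      walks′ : ∀ {y} → y ∈ R ∪ ⁅ b ⁆ → Walk G (R ∪ ⁅ b ⁆) y x
      walks′ y∈ with x∈p∪⁅y⁆⁻ y∈
      ... | inj₁ y∈R = walk-mono (p⊆p∪q ⁅ b ⁆) (walks y∈R)
      ... | inj₂ refl = step y∈ (Adj-sym a~b) (walk-mono (p⊆p∪q ⁅ b ⁆) (walks a∈R))
    ... | no stuck = inj₁ closed
      where
      closed : ClosedIn U R
      closed {a} {b} a∈R b∈U a~b with b ∈? R
      ... | yes b∈R = b∈R
      ... | no b∉R = ⊥-elim (stuck (b , b∈U , b∉R , a , a∈R , a~b))

  Dominates : Subset n → Subset n → Set
  Dominates S W = ∀ {y} → y ∈ W → y ∉ S → ∃ λ z → z ∈ S × Adj G y z

  independent-⁅⁆ : x ∈ U → Independent G U ⁅ x ⁆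
  independent-⁅⁆ {x} x∈U =
    x∈p⇒⁅x⁆⊆p x∈U , λ a∈ b∈ a~b → Adj⇒≢ a~b (trans (x∈⁅y⁆⇒x≡y x a∈) (≡-sym (x∈⁅y⁆⇒x≡y x b∈)))

  independent-∪⁅⁆ : Independent G U S → y ∈ U → (∀ {z} → z ∈ S → ¬ Adj G y z) →
                    Independent G U (S ∪ ⁅ y ⁆)
  independent-∪⁅⁆ {U} {S} {y} (S⊆U , S-ind) y∈U y≁S = ∪⁅⁆⊆ S⊆U y∈U , ind
    where
    ind : ∀ {a b} → a ∈ S ∪ ⁅ y ⁆ → b ∈ S ∪ ⁅ y ⁆ → ¬ Adj G a b
    ind a∈ b∈ with x∈p∪⁅y⁆⁻ a∈ | x∈p∪⁅y⁆⁻ b∈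
    ... | inj₁ a∈S  | inj₁ b∈S  = S-ind a∈S b∈S
    ... | inj₁ a∈S  | inj₂ refl = y≁S a∈S ∘ Adj-sym
    ... | inj₂ refl | inj₁ b∈S  = y≁S b∈S
    ... | inj₂ refl | inj₂ refl = λ y~y → Adj⇒≢ y~y refl

  dominating⇒maximal : Independent G U S → Dominates S U → MaximalIndependent G U S
  dominating⇒maximal {U} {S} S-ind dom = S-ind , maximal
    where
    maximal : ∀ J → Independent G U J → S ⊆ J → J ⊆ S
    maximal J (J⊆U , J-ind) S⊆J {y} y∈J with y ∈? S
    ... | yes y∈S = y∈S
    ... | no y∉S = let z , z∈S , y~z = dom (J⊆U y∈J) y∉S in ⊥-elim (J-ind y∈J (S⊆J z∈S) y~z)

  maximal⇒dominating : MaximalIndependent G U S → Dominates S U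
  maximal⇒dominating {U} {S} (S-ind , maximal) {y} y∈U y∉S
    with any? (λ z → z ∈? S ×-dec Adj? y z)
  ... | yes dominated = dominated
  ... | no y≁S = ⊥-elim (y∉S (maximal (S ∪ ⁅ y ⁆) S∪y-ind (p⊆p∪q ⁅ y ⁆) y∈p∪⁅y⁆))
    where
    S∪y-ind : Independent G U (S ∪ ⁅ y ⁆)
    S∪y-ind = independent-∪⁅⁆ S-ind y∈U (λ z∈S y~z → y≁S (_ , z∈S , y~z))

  maximal-restrict : ∀ {V} → V ⊆ U → S ⊆ V → MaximalIndependent G U S → MaximalIndependent G V S
  maximal-restrict V⊆U S⊆V ((_ , S-ind) , maximal) =
    (S⊆V , S-ind) , λ J (J⊆V , J-ind) → maximal J (V⊆U ∘ J⊆V , J-ind)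

  extend-to-maximal : Independent G U S → ∃ λ M → S ⊆ M × MaximalIndependent G U M
  extend-to-maximal {U} S-ind =
    let M , S⊆M , M-ind , M-dom = saturate (Independent G U) (λ M → Dominates M U) grow S-ind
    in M , S⊆M , dominating⇒maximal M-ind M-dom
    where
    grow : ∀ {S} → Independent G U S → Dominates S U ⊎ ∃ λ T → S ⊂ T × Independent G U T
    grow {S} S-ind with any? (λ y → y ∈? U ×-dec ¬? (y ∈? S) ×-dec ¬? (any? λ z → z ∈? S ×-dec Adj? y z))
    ... | yes (y , y∈U , y∉S , y≁S) =
      inj₂ (S ∪ ⁅ y ⁆ , (p⊆p∪q ⁅ y ⁆ , y , y∈p∪⁅y⁆ , y∉S) ,
            independent-∪⁅⁆ S-ind y∈U (λ z∈S y~z → y≁S (_ , z∈S , y~z)))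
    ... | no stuck = inj₁ dominated
      where
      dominated : Dominates S U
      dominated {y} y∈U y∉S with any? (λ z → z ∈? S ×-dec Adj? y z)
      ... | yes y~S = y~S
      ... | no y≁S = ⊥-elim (stuck (y , y∈U , y∉S , y≁S))

  maximal-without⇒maximal-with : MaximalIndependent G (U - v) S → v ∈ U →
                                 (∀ {z} → z ∈ S → ¬ Adj G v z) → MaximalIndependent G U (S ∪ ⁅ v ⁆)
  maximal-without⇒maximal-with {U} {v} {S} S-max@((S⊆U-v , S-ind) , _) v∈U v≁S =
    dominating⇒maximal (independent-∪⁅⁆ (p─q⊆p U ⁅ v ⁆ ∘ S⊆U-v , S-ind) v∈U v≁S) dom
    where
    dom : Dominates (S ∪ ⁅ v ⁆) U
    dom {y} y∈U y∉S∪v =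
      let z , z∈S , y~z = maximal⇒dominating S-max (x∈p∧x≢y⇒x∈p-y y∈U (y∉S∪v ∘ y≡v⇒∈)) (y∉S∪v ∘ p⊆p∪q ⁅ v ⁆)
      in z , p⊆p∪q ⁅ v ⁆ z∈S , y~z
      where
      y≡v⇒∈ : y ≡ v → y ∈ S ∪ ⁅ v ⁆
      y≡v⇒∈ refl = y∈p∪⁅y⁆

  dominated-removed⇒maximal : MaximalIndependent G (U - v) S → (∃ λ z → z ∈ S × Adj G v z) →
                              MaximalIndependent G U S
  dominated-removed⇒maximal {U} {v} {S} S-max@((S⊆U-v , S-ind) , _) v~S =
    dominating⇒maximal (p─q⊆p U ⁅ v ⁆ ∘ S⊆U-v , S-ind) dom
    where
    dom : Dominates S U
    dom {y} y∈U y∉S with y ≟ v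
    ... | yes refl = v~S
    ... | no y≢v = maximal⇒dominating S-max (x∈p∧x≢y⇒x∈p-y y∈U y≢v) y∉S

  maximal-size : ∀ {k M} → WellCovered G U → IsAlpha G U k → MaximalIndependent G U M → ∣ M ∣ ≡ k
  maximal-size wc ((K , K-ind , ∣K∣≡k) , bound) M-max =
    let M′ , K⊆M′ , M′-max = extend-to-maximal K-ind
    in trans (wc _ M′ M-max M′-max)
             (≤-antisym (bound M′ (proj₁ M′-max)) (subst (_≤ ∣ M′ ∣) ∣K∣≡k (p⊆q⇒∣p∣≤∣q∣ K⊆M′)))

  W₂⇒removed-dominated : InW2 G U → v ∈ U → u ∈ U → Adj G v u → MaximalIndependent G (U - v) S →
                         ∃ λ z → z ∈ S × Adj G v z
  W₂⇒removed-dominated {U} {v} {u} {S} (wc , wc-removed) v∈U u∈U v~u S-max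
    with any? (λ z → z ∈? S ×-dec Adj? v z)
  ... | yes v~S = v~S
  ... | no v≁S = ⊥-elim (<-irrefl (trans ∣S∣≡∣M∣ (≡-sym ∣S∪v∣≡∣M∣)) ∣S∣<∣S∪v∣)
    where
    S∪v-max : MaximalIndependent G U (S ∪ ⁅ v ⁆)
    S∪v-max = maximal-without⇒maximal-with S-max v∈U (λ z∈S v~z → v≁S (_ , z∈S , v~z))

    M-ext : ∃ λ M → ⁅ u ⁆ ⊆ M × MaximalIndependent G U M
    M-ext = extend-to-maximal (independent-⁅⁆ u∈U)

    M : Subset n
    M = proj₁ M-ext

    M-max : MaximalIndependent G U M
    M-max = proj₂ (proj₂ M-ext)

    v∉M : v ∉ M
    v∉M v∈M = proj₂ (proj₁ M-max) v∈M (proj₁ (proj₂ M-ext) (x∈⁅x⁆ u)) v~u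

    M-max-removed : MaximalIndependent G (U - v) M
    M-max-removed = maximal-restrict (p─q⊆p U ⁅ v ⁆)
      (λ y∈M → x∈p∧x≢y⇒x∈p-y (proj₁ (proj₁ M-max) y∈M) (λ { refl → v∉M y∈M })) M-max

    ∣S∣≡∣M∣ : ∣ S ∣ ≡ ∣ M ∣
    ∣S∣≡∣M∣ = proj₁ (wc-removed v v∈U) S M S-max M-max-removed

    ∣S∪v∣≡∣M∣ : ∣ S ∪ ⁅ v ⁆ ∣ ≡ ∣ M ∣
    ∣S∪v∣≡∣M∣ = wc _ M S∪v-max M-max

    ∣S∣<∣S∪v∣ : ∣ S ∣ < ∣ S ∪ ⁅ v ⁆ ∣
    ∣S∣<∣S∪v∣ = p⊂q⇒∣p∣<∣q∣ (p⊆p∪q ⁅ v ⁆ , v , y∈p∪⁅y⁆ , λ v∈S → x∈p-y⇒x≢y (proj₁ (proj₁ S-max) v∈S) refl)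

  maximal-lifts⇒W₂ : WellCovered G U →
                     (∀ {v S} → v ∈ U → MaximalIndependent G (U - v) S → MaximalIndependent G U S) →
                     InW2 G U
  maximal-lifts⇒W₂ {U} wc lift = wc , λ v v∈U →
    (λ I J I-max J-max → wc I J (lift v∈U I-max) (lift v∈U J-max)) , α-preserved v∈U
    where
    α-preserved : ∀ {v} → v ∈ U → ∀ k → IsAlpha G U k → IsAlpha G (U - v) k
    α-preserved {v} v∈U k α@(_ , bound) =
      let M , _ , M-max = extend-to-maximal {S = ⊥} (⊥⊆ , λ x∈⊥ → contradiction x∈⊥ ∉⊥)
      in (M , proj₁ M-max , maximal-size wc α (lift v∈U M-max)) ,
         λ I (I⊆U-v , I-ind) → bound I (p─q⊆p U ⁅ v ⁆ ∘ I⊆U-v , I-ind)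

  N : Fin n → Subset n
  N v = select (Adj? v)

  ∈N⁺ : Adj G v y → y ∈ N v
  ∈N⁺ {v} = ∈select⁺ (Adj? v)

  ∈N⁻ : y ∈ N v → Adj G v y
  ∈N⁻ {v = v} = ∈select⁻ (Adj? v)

  ∈Gv⁺ : y ≢ v → ¬ Adj G v y → y ∈ Gv G v
  ∈Gv⁺ {y} {v} y≢v v≁y = lookup⇒[]= y (Gv G v) (trans (lookup∘tabulate _ y) (member (y ≟ v) (adj G v y) v≁y))
    where
    member : (y≟v : Dec (y ≡ v)) (b : Bool) → b ≢ true → not ⌊ y≟v ⌋ ∧ not b ≡ true
    member (yes y≡v) _     _      = ⊥-elim (y≢v y≡v)
    member (no _)    false _      = refl
    member (no _)    true  b≢true = ⊥-elim (b≢true refl)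

  ∈Gv⁻ : y ∈ Gv G v → y ≢ v × ¬ Adj G v y
  ∈Gv⁻ {y} {v} y∈Gv = member (y ≟ v) (adj G v y) (trans (≡-sym (lookup∘tabulate _ y)) ([]=⇒lookup y∈Gv))
    where
    member : (y≟v : Dec (y ≡ v)) (b : Bool) → not ⌊ y≟v ⌋ ∧ not b ≡ true → y ≢ v × b ≢ true
    member (yes _)   _     ()
    member (no y≢v)  false _ = y≢v , λ ()
    member (no _)    true  ()

  N[_]⊆N[_] : Fin n → Fin n → Set
  N[ v ]⊆N[ y ] = ∀ u → Adj G v u → Adj G u y

  N[_]⊆N[_]? : ∀ v y → Dec N[ v ]⊆N[ y ]
  N[ v ]⊆N[ y ]? = all? (λ u → Adj? v u →-dec Adj? u y)

  N⊆N⇒join : Adj G v u → (∀ {b} → b ∈ Gv G v → N[ v ]⊆N[ b ]) → IsJoin G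
  N⊆N⇒join {v} {u} v~u N⊆N = N v , (u , ∈N⁺ v~u) , (v , x∉p⇒x∈∁p (λ v∈N → Adj⇒≢ (∈N⁻ v∈N) refl)) , join
    where
    join : ∀ {x y} → x ∈ N v → y ∉ N v → Adj G x y
    join {x} {y} x∈N y∉N with y ≟ v
    ... | yes refl = Adj-sym (∈N⁻ x∈N)
    ... | no y≢v = N⊆N (∈Gv⁺ y≢v (y∉N ∘ ∈N⁺)) x (∈N⁻ x∈N)

module _ {n : ℕ} (G : Graph n) (ltf : LocallyTriangleFree G)
         (components-W₂ : ∀ v C → IsComponent G (Gv G v) C → 2 ≤ ∣ C ∣ → InW2 G C) where

  open GraphProperties G

  private
    variable
      I C : Subset n
      a b c d u v : Fin n

  edge-component : a ∈ Gv G x → b ∈ Gv G x → Adj G a b →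
                   ∃ λ C → IsComponent G (Gv G x) C × a ∈ C × b ∈ C × InW2 G C
  edge-component {x = x} a∈Gv b∈Gv a~b =
    let C , C-comp , a∈C = component-of a∈Gv
        b∈C = proj₂ (proj₂ (proj₂ C-comp)) a∈C b∈Gv a~b
    in C , C-comp , a∈C , b∈C , components-W₂ x C C-comp (distinct⇒2≤∣p∣ a∈C b∈C (Adj⇒≢ a~b))

  maximal-in-component : MaximalIndependent G (Gv G v) I → Dominates I (N v) → x ∈ I →
                         IsComponent G (Gv G x) C → MaximalIndependent G (C - v) (C ∩ I)
  maximal-in-component {v} {I} {x} {C} I-max@((I⊆Gv , I-ind) , _) I-dom x∈I (C⊆Gvx , _ , _ , C-closed) =
    dominating⇒maximal (C∩I⊆C-v , λ y∈ z∈ → I-ind (proj₂ (x∈p∩q⁻ C I y∈)) (proj₂ (x∈p∩q⁻ C I z∈))) dom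
    where
    C∩I⊆C-v : C ∩ I ⊆ C - v
    C∩I⊆C-v y∈C∩I = let y∈C , y∈I = x∈p∩q⁻ C I y∈C∩I in x∈p∧x≢y⇒x∈p-y y∈C (proj₁ (∈Gv⁻ (I⊆Gv y∈I)))

    I-neighbour : ∀ {y} → y ≢ v → y ∉ I → ∃ λ z → z ∈ I × Adj G y z
    I-neighbour {y} y≢v y∉I with Adj? v y
    ... | yes v~y = I-dom (∈N⁺ v~y) y∉I
    ... | no v≁y = maximal⇒dominating I-max (∈Gv⁺ y≢v v≁y) y∉I

    dom : Dominates (C ∩ I) (C - v)
    dom {y} y∈C-v y∉C∩I =
      let z , z∈I , y~z = I-neighbour (x∈p-y⇒x≢y y∈C-v) (λ y∈I → y∉C∩I (x∈p∩q⁺ (y∈C , y∈I)))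
          z∈Gvx = ∈Gv⁺ (λ z≡x → x≁y (Adj-sym (subst (Adj G y) z≡x y~z))) (I-ind x∈I z∈I)
      in z , x∈p∩q⁺ (C-closed y∈C z∈Gvx y~z , z∈I) , y~z
      where
      y∈C : y ∈ C
      y∈C = p─q⊆p C ⁅ v ⁆ y∈C-v

      x≁y : ¬ Adj G x y
      x≁y = proj₂ (∈Gv⁻ (C⊆Gvx y∈C))

  maximal-dominating-N⇒N⊆N : MaximalIndependent G (Gv G v) I → Dominates I (N v) → x ∈ I → N[ v ]⊆N[ x ]
  maximal-dominating-N⇒N⊆N {v} {I} {x} I-max@((I⊆Gv , _) , _) I-dom x∈I u v~u with Adj? u x
  ... | yes u~x = u~x
  ... | no u≁x =
    let C , C-comp , v∈C , u∈C , C-W₂ = edge-component v∈Gvx u∈Gvx v~u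
        z , z∈C∩I , v~z = W₂⇒removed-dominated C-W₂ v∈C u∈C v~u (maximal-in-component I-max I-dom x∈I C-comp)
    in ⊥-elim (proj₂ (∈Gv⁻ (I⊆Gv (proj₂ (x∈p∩q⁻ C I z∈C∩I)))) v~z)
    where
    v≁x : ¬ Adj G v x
    v≁x = proj₂ (∈Gv⁻ (I⊆Gv x∈I))

    v∈Gvx : v ∈ Gv G x
    v∈Gvx = ∈Gv⁺ (proj₁ (∈Gv⁻ (I⊆Gv x∈I)) ∘ ≡-sym) (v≁x ∘ Adj-sym)

    u∈Gvx : u ∈ Gv G x
    u∈Gvx = ∈Gv⁺ (λ { refl → v≁x v~u }) (u≁x ∘ Adj-sym)

  N⊈N⇒adjacent : c ∈ Gv G v → ¬ N[ v ]⊆N[ c ] → d ∈ Gv G v → N[ v ]⊆N[ d ] → Adj G c d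
  N⊈N⇒adjacent {c} {v} {d} c∈Gv c-out d∈Gv d-in with Adj? c d
  ... | yes c~d = c~d
  ... | no c≁d =
    let I , d∪c⊆I , I-max = extend-to-maximal (independent-∪⁅⁆ (independent-⁅⁆ d∈Gv) c∈Gv c≁⁅d⁆)
        d∈I = d∪c⊆I (p⊆p∪q ⁅ c ⁆ (x∈⁅x⁆ d))
    in ⊥-elim (c-out (maximal-dominating-N⇒N⊆N I-max (λ u∈N _ → d , d∈I , d-in _ (∈N⁻ u∈N)) (d∪c⊆I y∈p∪⁅y⁆)))
    where
    c≁⁅d⁆ : ∀ {z} → z ∈ ⁅ d ⁆ → ¬ Adj G c z
    c≁⁅d⁆ z∈⁅d⁆ with x∈⁅y⁆⇒x≡y d z∈⁅d⁆
    ... | refl = c≁d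

  Covering : Fin n → Subset n
  Covering v = select (λ y → N[ v ]⊆N[ y ]?)

  ∈covering-part⁻ : y ∈ C ∩ Covering v - a → y ∈ C × N[ v ]⊆N[ y ] × y ≢ a
  ∈covering-part⁻ {C = C} {v = v} {a = a} y∈ =
    let y∈C , y∈Cov = x∈p∩q⁻ C (Covering v) (p─q⊆p (C ∩ Covering v) ⁅ a ⁆ y∈)
    in y∈C , ∈select⁻ (λ y → N[ v ]⊆N[ y ]?) y∈Cov , x∈p-y⇒x≢y y∈

  ∈covering-part⁺ : y ∈ C → N[ v ]⊆N[ y ] → y ≢ a → y ∈ C ∩ Covering v - a
  ∈covering-part⁺ {v = v} y∈C y-in y≢a =
    x∈p∧x≢y⇒x∈p-y (x∈p∩q⁺ (y∈C , ∈select⁺ (λ y → N[ v ]⊆N[ y ]?) y-in)) y≢a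

  N⊆N-independent : b ∈ Gv G v → ¬ N[ v ]⊆N[ b ] → c ∈ Gv G v → N[ v ]⊆N[ c ] →
                    d ∈ Gv G v → N[ v ]⊆N[ d ] → ¬ Adj G c d
  N⊆N-independent {v = v} b∈Gv b-out c∈Gv c-in d∈Gv d-in c~d =
    ltf v c∈Gv d∈Gv b∈Gv c~d (Adj-sym (N⊈N⇒adjacent b∈Gv b-out d∈Gv d-in))
                             (Adj-sym (N⊈N⇒adjacent b∈Gv b-out c∈Gv c-in))

  covering-part-maximal : b ∈ Gv G v → ¬ N[ v ]⊆N[ b ] → IsComponent G (Gv G v) C →
                          a ∈ C → N[ v ]⊆N[ a ] → c ∈ C → N[ v ]⊆N[ c ] → a ≢ c →
                          MaximalIndependent G (C - a) (C ∩ Covering v - a)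
  covering-part-maximal {b} {v} {C} {a} {c} b∈Gv b-out (C⊆Gv , _) a∈C a-in c∈C c-in a≢c =
    dominating⇒maximal (part⊆C-a , independent) dom
    where
    part⊆C-a : C ∩ Covering v - a ⊆ C - a
    part⊆C-a y∈ = let y∈C , _ , y≢a = ∈covering-part⁻ y∈ in x∈p∧x≢y⇒x∈p-y y∈C y≢a

    independent : ∀ {y z} → y ∈ C ∩ Covering v - a → z ∈ C ∩ Covering v - a → ¬ Adj G y z
    independent y∈ z∈ =
      let y∈C , y-in , _ = ∈covering-part⁻ y∈
          z∈C , z-in , _ = ∈covering-part⁻ z∈
      in N⊆N-independent b∈Gv b-out (C⊆Gv y∈C) y-in (C⊆Gv z∈C) z-in

    dom : Dominates (C ∩ Covering v - a) (C - a)
    dom {y} y∈C-a y∉part with N[ v ]⊆N[ y ]?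
    ... | yes y-in = ⊥-elim (y∉part (∈covering-part⁺ (p─q⊆p C ⁅ a ⁆ y∈C-a) y-in (x∈p-y⇒x≢y y∈C-a)))
    ... | no y-out = c , ∈covering-part⁺ c∈C c-in (a≢c ∘ ≡-sym) ,
                     N⊈N⇒adjacent (C⊆Gv (p─q⊆p C ⁅ a ⁆ y∈C-a)) y-out (C⊆Gv c∈C) c-in

  two-N⊆N⇒join : Adj G v u → a ∈ Gv G v → N[ v ]⊆N[ a ] → c ∈ Gv G v → N[ v ]⊆N[ c ] → a ≢ c → IsJoin G
  two-N⊆N⇒join {v} v~u a∈Gv a-in c∈Gv c-in a≢c with any? (λ b → b ∈? Gv G v ×-dec ¬? (N[ v ]⊆N[ b ]?))
  ... | no none =
    N⊆N⇒join v~u (λ {b} b∈Gv → decidable-stable (N[ v ]⊆N[ b ]?) (λ b-out → none (b , b∈Gv , b-out)))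
  ... | yes (b , b∈Gv , b-out) =
    let b~a = N⊈N⇒adjacent b∈Gv b-out a∈Gv a-in
        C , C-comp , b∈C , a∈C , C-W₂ = edge-component b∈Gv a∈Gv b~a
        c∈C = proj₂ (proj₂ (proj₂ C-comp)) b∈C c∈Gv (N⊈N⇒adjacent b∈Gv b-out c∈Gv c-in)
        part-max = covering-part-maximal b∈Gv b-out C-comp a∈C a-in c∈C c-in a≢c
        z , z∈part , a~z = W₂⇒removed-dominated C-W₂ a∈C b∈C (Adj-sym b~a) part-max
        z∈C , z-in , _ = ∈covering-part⁻ z∈part
    in ⊥-elim (N⊆N-independent b∈Gv b-out a∈Gv a-in (proj₁ C-comp z∈C) z-in a~z)

  removed-vertex-dominated : ∀ {k} → WellCovered G ⊤ → IsAlpha G ⊤ k → 3 ≤ k → ¬ IsJoin G → Adj G v u →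
                             MaximalIndependent G (⊤ - v) I → ∃ λ z → z ∈ I × Adj G v z
  removed-vertex-dominated {v} {u} {I} {k} wc α 3≤k ¬join v~u I-max with any? (λ z → z ∈? I ×-dec Adj? v z)
  ... | yes v~I = v~I
  ... | no v≁I =
    let g₁ , g₂ , g₁∈I , g₂∈I , g₁≢g₂ = 2≤∣p∣⇒distinct 2≤∣I∣
    in ⊥-elim (¬join (two-N⊆N⇒join v~u (I⊆Gv g₁∈I) (I⊆N g₁∈I) (I⊆Gv g₂∈I) (I⊆N g₂∈I) g₁≢g₂))
    where
    v≁I′ : ∀ {z} → z ∈ I → ¬ Adj G v z
    v≁I′ z∈I v~z = v≁I (_ , z∈I , v~z)

    I⊆Gv : I ⊆ Gv G v
    I⊆Gv z∈I = ∈Gv⁺ (x∈p-y⇒x≢y (proj₁ (proj₁ I-max) z∈I)) (v≁I′ z∈I)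

    I-max-Gv : MaximalIndependent G (Gv G v) I
    I-max-Gv = maximal-restrict (λ y∈Gv → x∈p∧x≢y⇒x∈p-y ∈⊤ (proj₁ (∈Gv⁻ y∈Gv))) I⊆Gv I-max

    I-dom : Dominates I (N v)
    I-dom y∈N = maximal⇒dominating I-max (x∈p∧x≢y⇒x∈p-y ∈⊤ (λ { refl → Adj⇒≢ (∈N⁻ y∈N) refl }))

    I⊆N : ∀ {z} → z ∈ I → N[ v ]⊆N[ z ]
    I⊆N = maximal-dominating-N⇒N⊆N I-max-Gv I-dom

    2≤∣I∣ : 2 ≤ ∣ I ∣
    2≤∣I∣ = s≤s⁻¹ (≤-trans 3≤k (subst (_≤ suc ∣ I ∣) ∣I∪v∣≡k (∣p∪⁅x⁆∣≤1+∣p∣ I v)))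
      where
      ∣I∪v∣≡k : ∣ I ∪ ⁅ v ⁆ ∣ ≡ k
      ∣I∪v∣≡k = maximal-size wc α (maximal-without⇒maximal-with I-max ∈⊤ v≁I′)

lemma4p2 : ∀ {n : ℕ} (G : Graph n) →
    NoIsolated G →
    WellCovered G ⊤ →
    LocallyTriangleFree G →
    Connected G ⊤ →
    (∃ λ k → IsAlpha G ⊤ k × 3 ≤ k) →
    ¬ IsJoin G →
    (∀ v C → IsComponent G (Gv G v) C → 2 ≤ ∣ C ∣ → InW2 G C) →
    InW2 G ⊤
lemma4p2 G no-isolated wc ltf _ (k , α , 3≤k) ¬join components-W₂ =
  maximal-lifts⇒W₂ wc λ {v} _ S-max →
    dominated-removed⇒maximal S-max
      (removed-vertex-dominated G ltf components-W₂ wc α 3≤k ¬join (proj₂ (no-isolated v)) S-max)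
  where open GraphProperties G
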